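{- Let $\mathcal{A}_1,\dots,\mathcal{A}_n$ and $\mathcal{B}$ be path categories and let $\widehat H\colon\prod_i\mathcal{A}_i\to\mathcal{B}$ be a functor satisfying (S1) and (S2) below. If $f_1,\dots,f_n$ are open pathwise-embeddings in $\mathcal{A}_1,\dots,\mathcal{A}_n$ respectively, then $\widehat H(f_1,\dots,f_n)$ is an open pathwise-embedding in $\mathcal{B}$. (S1) If each $e_i$ is an embedding in $\mathcal{A}_i$, then $\widehat H(e_1,\dots,e_n)$ is an embedding. (S2) Every path embedding $e\colon P\rightarrowtail\widehat H(A_1,\dots,A_n)$ has a minimal decomposition $e=\widehat H(e_1,\dots,e_n)\circ e_0$ with $e_0\colon P\to\widehat H(P_1,\dots,P_n)$ and path embeddings $e_i\colon P_i\rightarrowtail A_i$; minimality means that for any decomposition $e=\widehat H(g_1,\dots,g_n)\circ g_0$ with $g_0\colon P\to\widehat H(Q_1,\dots,Q_n)$ and path embeddings $g_i\colon Q_i\rightarrowtail A_i$, there exist (necessarily unique) morphisms $h_i\colon P_i\to Q_i$ with $e_i=g_i\circ h_i$ for all $i$.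
   Context: A path category is a category equipped with a proper factorisation system $(\mathcal{E},\mathcal{M})$ (every morphism factors as $m\circ e$ with $e\in\mathcal{E}$, $m\in\mathcal{M}$; $\mathcal{E}$ and $\mathcal{M}$ determine each other by weak orthogonality, i.e. existence of diagonal fillers of commuting squares; $\mathcal{E}$ consists of epis and $\mathcal{M}$ of monos) together with a chosen class of objects called paths. Members of $\mathcal{M}$ are embeddings; a path embedding is an embedding with domain a path. A morphism $f\colon X\to Y$ is a pathwise-embedding if $f\circ e$ is an embedding for every path embedding $e\colon P\rightarrowtail X$. It is open if for every commutative square $f\circ e=m\circ g$ with $e\colon P\rightarrowtail X$, $g\colon P\rightarrowtail Q$, $m\colon Q\rightarrowtail Y$ path embeddings, there exists $d\colon Q\to X$ with $d\circ g=e$ and $f\circ d=m$. -}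

module Defs where

open import Level using (Level; _⊔_) renaming (suc to lsuc)
open import Data.Nat using (ℕ)
open import Data.Fin using (Fin)
open import Data.Product using (Σ; _×_; _,_)
open import Relation.Binary.PropositionalEquality using (_≡_)

record Category (o ℓ : Level) : Set (lsuc (o ⊔ ℓ)) where
  infixr 9 _∘_
  field
    Obj  : Set o
    Hom  : Obj → Obj → Set ℓ
    id   : ∀ {A} → Hom A A
    _∘_  : ∀ {A B C} → Hom B C → Hom A B → Hom A C
    assoc : ∀ {A B C D} (f : Hom A B) (g : Hom B C) (h : Hom C D) →
            (h ∘ g) ∘ f ≡ h ∘ (g ∘ f)
    identityˡ : ∀ {A B} (f : Hom A B) → id ∘ f ≡ f
    identityʳ : ∀ {A B} (f : Hom A B) → f ∘ id ≡ f

  Mono : ∀ {A B} → Hom A B → Set (o ⊔ ℓ)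
  Mono {A} m = ∀ {C} (g h : Hom C A) → m ∘ g ≡ m ∘ h → g ≡ h

  Epi : ∀ {A B} → Hom A B → Set (o ⊔ ℓ)
  Epi {B = B} e = ∀ {C} (g h : Hom B C) → g ∘ e ≡ h ∘ e → g ≡ h

  HasFiller : ∀ {A B C D} → Hom A B → Hom C D → Set ℓ
  HasFiller {A} {B} {C} {D} e m =
    (u : Hom A C) (v : Hom B D) → v ∘ e ≡ m ∘ u →
    Σ (Hom B C) λ d → (d ∘ e ≡ u) × (m ∘ d ≡ v)

-- Path categories: a category with a proper (weak) factorisation system
-- (E , M) and a chosen class of objects called paths.
record PathCategory (o ℓ : Level) : Set (lsuc (o ⊔ ℓ)) where
  field
    cat : Category o ℓ
  open Category cat public
  field
    E : ∀ {A B} → Hom A B → Set ℓ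
    M : ∀ {A B} → Hom A B → Set ℓ
    factor : ∀ {A B} (f : Hom A B) →
      Σ Obj λ C → Σ (Hom A C) λ e → Σ (Hom C B) λ m → E e × M m × (m ∘ e ≡ f)
    E⇒⧄M : ∀ {A B} (e : Hom A B) → E e →
      ∀ {C D} (m : Hom C D) → M m → HasFiller e m
    ⧄M⇒E : ∀ {A B} (e : Hom A B) →
      (∀ {C D} (m : Hom C D) → M m → HasFiller e m) → E e
    M⇒E⧄ : ∀ {C D} (m : Hom C D) → M m →
      ∀ {A B} (e : Hom A B) → E e → HasFiller e m
    E⧄⇒M : ∀ {C D} (m : Hom C D) →
      (∀ {A B} (e : Hom A B) → E e → HasFiller e m) → M m
    E-epi  : ∀ {A B} (e : Hom A B) → E e → Epi e
    M-mono : ∀ {A B} (m : Hom A B) → M m → Mono m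
    IsPath : Obj → Set ℓ

module _ {o ℓ : Level} (C : PathCategory o ℓ) where
  open PathCategory C

  Embedding : ∀ {A B} → Hom A B → Set ℓ
  Embedding = M

  PathEmbedding : ∀ {P X} → Hom P X → Set ℓ
  PathEmbedding {P} e = IsPath P × Embedding e

  PathwiseEmbedding : ∀ {X Y} → Hom X Y → Set (o ⊔ ℓ)
  PathwiseEmbedding {X} f =
    ∀ {P} (e : Hom P X) → PathEmbedding e → Embedding (f ∘ e)

  Open : ∀ {X Y} → Hom X Y → Set (o ⊔ ℓ)
  Open {X} {Y} f =
    ∀ {P Q} (e : Hom P X) (g : Hom P Q) (m : Hom Q Y) →
    PathEmbedding e → PathEmbedding g → PathEmbedding m →
    f ∘ e ≡ m ∘ g →
    Σ (Hom Q X) λ d → (d ∘ g ≡ e) × (f ∘ d ≡ m)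

-- A functor  Ĥ : ∏_{i : Fin n} A i → B  (product category, with morphisms
-- compared componentwise).
record MultiFunctor {o ℓ o' ℓ' : Level} (n : ℕ)
       (A : Fin n → PathCategory o ℓ) (B : PathCategory o' ℓ')
       : Set (o ⊔ ℓ ⊔ o' ⊔ ℓ') where
  private
    module A i = PathCategory (A i)
    module B = PathCategory B
  field
    F₀ : ((i : Fin n) → A.Obj i) → B.Obj
    F₁ : ∀ {X Y : (i : Fin n) → A.Obj i} →
         ((i : Fin n) → A.Hom i (X i) (Y i)) → B.Hom (F₀ X) (F₀ Y)
    F-resp : ∀ {X Y : (i : Fin n) → A.Obj i}
             (f g : (i : Fin n) → A.Hom i (X i) (Y i)) →
             (∀ i → f i ≡ g i) → F₁ f ≡ F₁ g
    F-id : ∀ {X : (i : Fin n) → A.Obj i} →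
           F₁ {X} {X} (λ i → A.id i) ≡ B.id
    F-∘ : ∀ {X Y Z : (i : Fin n) → A.Obj i}
          (f : (i : Fin n) → A.Hom i (X i) (Y i))
          (g : (i : Fin n) → A.Hom i (Y i) (Z i)) →
          F₁ (λ i → A._∘_ i (g i) (f i)) ≡ B._∘_ (F₁ g) (F₁ f)

module _ {o ℓ o' ℓ' : Level} {n : ℕ}
         {A : Fin n → PathCategory o ℓ} {B : PathCategory o' ℓ'}
         (H : MultiFunctor n A B) where
  private
    module A i = PathCategory (A i)
    module B = PathCategory B
  open MultiFunctor H

  S1 : Set (o ⊔ ℓ ⊔ ℓ')
  S1 = ∀ {X Y : (i : Fin n) → A.Obj i}
         (e : (i : Fin n) → A.Hom i (X i) (Y i)) →
         (∀ i → Embedding (A i) (e i)) → Embedding B (F₁ e)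

  S2 : Set (o ⊔ ℓ ⊔ o' ⊔ ℓ')
  S2 = ∀ (X : (i : Fin n) → A.Obj i) {P : B.Obj} (e : B.Hom P (F₀ X)) →
       PathEmbedding B e →
       Σ ((i : Fin n) → A.Obj i) λ Ps →
       Σ (B.Hom P (F₀ Ps)) λ e₀ →
       Σ ((i : Fin n) → A.Hom i (Ps i) (X i)) λ es →
         (∀ i → PathEmbedding (A i) (es i))
       × (B._∘_ (F₁ es) e₀ ≡ e)
       × (∀ (Qs : (i : Fin n) → A.Obj i) (g₀ : B.Hom P (F₀ Qs))
            (gs : (i : Fin n) → A.Hom i (Qs i) (X i)) →
            (∀ i → PathEmbedding (A i) (gs i)) →
            B._∘_ (F₁ gs) g₀ ≡ e →
            Σ ((i : Fin n) → A.Hom i (Ps i) (Qs i)) λ hs →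
              ∀ i → es i ≡ A._∘_ i (gs i) (hs i))

{-# OPTIONS --safe #-}
module Submission where

-- Decompose a path embedding e : P ↣ Ĥ(X) as Ĥ(e₁,…,eₙ) ∘ e₀ by (S2); since Ĥ(e₁,…,eₙ) is
-- mono by (S1), e₀ is an embedding, and Ĥ f ∘ e = Ĥ(f₁ ∘ e₁,…,fₙ ∘ eₙ) ∘ e₀ is one too.
-- For openness, take a minimal decomposition k of the path embedding m ∘ g = Ĥ f ∘ e.
-- Minimality maps the legs of k into the legs of the decompositions of m ∘ g induced by e
-- and by m; this gives, in each component, a square of path embeddings against fᵢ, which
-- the openness of fᵢ fills. Applying Ĥ to these fillers and precomposing with the head of
-- the decomposition of m fills the original square.

open import Defs
open import Level using (Level; _⊔_)
open import Data.Nat using (ℕ)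
open import Data.Fin using (Fin)
open import Data.Product using (Σ; _×_; _,_; proj₁; proj₂)
open import Relation.Binary.PropositionalEquality
  using (_≡_; refl; sym; trans; cong; subst; module ≡-Reasoning)

module EmbeddingProperties {o ℓ : Level} (C : PathCategory o ℓ) where
  open PathCategory C

  M-∘ : ∀ {X Y Z} {m : Hom Y Z} {m′ : Hom X Y} → M m → M m′ → M (m ∘ m′)
  M-∘ {m = m} {m′} m∈M m′∈M = E⧄⇒M (m ∘ m′) λ e e∈E u v v∘e≡mm′∘u →
    let (d , d∘e≡m′∘u , m∘d≡v) =
          E⇒⧄M e e∈E m m∈M (m′ ∘ u) v (trans v∘e≡mm′∘u (assoc u m′ m))
        (d′ , d′∘e≡u , m′∘d′≡d) = E⇒⧄M e e∈E m′ m′∈M u d d∘e≡m′∘u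
    in d′ , d′∘e≡u , trans (assoc d′ m′ m) (trans (cong (m ∘_) m′∘d′≡d) m∘d≡v)

  M-cancelˡ : ∀ {X Y Z} {m : Hom Y Z} {g : Hom X Y} → Mono m → M (m ∘ g) → M g
  M-cancelˡ {m = m} {g} m-mono m∘g∈M = E⧄⇒M g λ e e∈E u v v∘e≡g∘u →
    let (d , d∘e≡u , mg∘d≡m∘v) =
          E⇒⧄M e e∈E (m ∘ g) m∘g∈M u (m ∘ v)
            (trans (assoc e v m) (trans (cong (m ∘_) v∘e≡g∘u) (sym (assoc u g m))))
    in d , d∘e≡u , m-mono (g ∘ d) v (trans (sym (assoc d g m)) mg∘d≡m∘v)

  PathEmbedding-∘ : ∀ {P Y Z} {m : Hom Y Z} {g : Hom P Y} →
                    Embedding C m → PathEmbedding C g → PathEmbedding C (m ∘ g)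
  PathEmbedding-∘ m∈M (P-path , g∈M) = P-path , M-∘ m∈M g∈M

module _ {o ℓ o′ ℓ′ : Level} {n : ℕ}
         {A : Fin n → PathCategory o ℓ} {B : PathCategory o′ ℓ′}
         (H : MultiFunctor n A B) where
  private
    module A i = PathCategory (A i)
    module EA i = EmbeddingProperties (A i)
  open PathCategory B
  open EmbeddingProperties B
  open MultiFunctor H

  Objs : Set o
  Objs = (i : Fin n) → A.Obj i

  Homs : Objs → Objs → Set ℓ
  Homs X Y = (i : Fin n) → A.Hom i (X i) (Y i)

  infixr 9 _⊚_
  _⊚_ : ∀ {X Y Z} → Homs Y Z → Homs X Y → Homs X Z
  (g ⊚ f) i = A._∘_ i (g i) (f i)

  F₁-⊚ : ∀ {X Y Z} {g : Homs Y Z} {f : Homs X Y} {h : Homs X Z} →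
         (∀ i → h i ≡ (g ⊚ f) i) → F₁ h ≡ F₁ g ∘ F₁ f
  F₁-⊚ {g = g} {f} h≗g⊚f = trans (F-resp _ _ h≗g⊚f) (F-∘ f g)

  record Decomposition {X : Objs} {P : Obj} (e : Hom P (F₀ X)) : Set (o ⊔ ℓ ⊔ ℓ′) where
    field
      Ps         : Objs
      head       : Hom P (F₀ Ps)
      legs       : Homs Ps X
      legs-path  : ∀ i → PathEmbedding (A i) (legs i)
      factorises : F₁ legs ∘ head ≡ e

  open Decomposition

  record DecompositionMap {X P} {e : Hom P (F₀ X)} (D D′ : Decomposition e) : Set ℓ where
    field
      maps         : Homs (Ps D) (Ps D′)
      legs-commute : ∀ i → legs D i ≡ (legs D′ ⊚ maps) i

  open DecompositionMap

  IsMinimal : ∀ {X P} {e : Hom P (F₀ X)} → Decomposition e → Set (o ⊔ ℓ ⊔ ℓ′)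
  IsMinimal D = ∀ D′ → DecompositionMap D D′

  minimalDecomposition : S2 H → ∀ {X P} {e : Hom P (F₀ X)} →
                         PathEmbedding B e → Σ (Decomposition e) IsMinimal
  minimalDecomposition s2 {X} {e = e} e-path
    with s2 X e e-path
  ... | Qs , e₀ , es , es-path , es∘e₀≡e , minimal =
    record { Ps = Qs ; head = e₀ ; legs = es ; legs-path = es-path ; factorises = es∘e₀≡e } ,
    λ D′ → let (hs , es≗gs∘hs) = minimal (Ps D′) (head D′) (legs D′) (legs-path D′) (factorises D′)
           in record { maps = hs ; legs-commute = es≗gs∘hs }

  transport : ∀ {X P} {e e′ : Hom P (F₀ X)} → e ≡ e′ → Decomposition e → Decomposition e′
  transport e≡e′ D = record
    { Ps = Ps D ; head = head D ; legs = legs D ; legs-path = legs-path D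
    ; factorises = trans (factorises D) e≡e′ }

  precompose : ∀ {X P Q} {e : Hom P (F₀ X)} (D : Decomposition e) (g : Hom Q P) →
               Decomposition (e ∘ g)
  precompose D g = record
    { Ps         = Ps D
    ; head       = head D ∘ g
    ; legs       = legs D
    ; legs-path  = legs-path D
    ; factorises = trans (sym (assoc g (head D) (F₁ (legs D)))) (cong (_∘ g) (factorises D))
    }

  postcompose : ∀ {X Y P} {e : Hom P (F₀ X)} {f : Homs X Y} →
                (∀ i → PathwiseEmbedding (A i) (f i)) →
                Decomposition e → Decomposition (F₁ f ∘ e)
  postcompose {e = e} {f} f-pw D = record
    { Ps         = Ps D
    ; head       = head D
    ; legs       = f ⊚ legs D
    ; legs-path  = λ i → proj₁ (legs-path D i) , f-pw i (legs D i) (legs-path D i)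
    ; factorises = begin
        F₁ (f ⊚ legs D) ∘ head D     ≡⟨ cong (_∘ head D) (F₁-⊚ λ _ → refl) ⟩
        (F₁ f ∘ F₁ (legs D)) ∘ head D ≡⟨ assoc (head D) (F₁ (legs D)) (F₁ f) ⟩
        F₁ f ∘ (F₁ (legs D) ∘ head D) ≡⟨ cong (F₁ f ∘_) (factorises D) ⟩
        F₁ f ∘ e                      ∎
    }
    where open ≡-Reasoning

  maps-pathEmbedding : ∀ {X P} {e : Hom P (F₀ X)} {D D′ : Decomposition e} →
                       (φ : DecompositionMap D D′) → ∀ i → PathEmbedding (A i) (maps φ i)
  maps-pathEmbedding {D = D} {D′} φ i =
    proj₁ (legs-path D i) ,
    EA.M-cancelˡ i (A.M-mono i _ (proj₂ (legs-path D′ i)))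
                   (subst (A.M i) (legs-commute φ i) (proj₂ (legs-path D i)))

  module _ (s1 : S1 H) where

    legs-mono : ∀ {X P} {e : Hom P (F₀ X)} (D : Decomposition e) → Mono (F₁ (legs D))
    legs-mono D = M-mono _ (s1 (legs D) λ i → proj₂ (legs-path D i))

    head-embedding : ∀ {X P} {e : Hom P (F₀ X)} (D : Decomposition e) →
                     Embedding B e → Embedding B (head D)
    head-embedding D e∈M = M-cancelˡ (legs-mono D) (subst M (sym (factorises D)) e∈M)

    embedding-from-head : ∀ {X P} {e : Hom P (F₀ X)} (D : Decomposition e) →
                          Embedding B (head D) → Embedding B e
    embedding-from-head D head∈M =
      subst M (factorises D) (M-∘ (s1 (legs D) λ i → proj₂ (legs-path D i)) head∈M)

    head-commute : ∀ {X P} {e : Hom P (F₀ X)} {D D′ : Decomposition e} →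
                   (φ : DecompositionMap D D′) → head D′ ≡ F₁ (maps φ) ∘ head D
    head-commute {e = e} {D} {D′} φ = legs-mono D′ _ _ (begin
      F₁ (legs D′) ∘ head D′                 ≡⟨ factorises D′ ⟩
      e                                       ≡⟨ sym (factorises D) ⟩
      F₁ (legs D) ∘ head D                    ≡⟨ cong (_∘ head D) (F₁-⊚ (legs-commute φ)) ⟩
      (F₁ (legs D′) ∘ F₁ (maps φ)) ∘ head D   ≡⟨ assoc (head D) (F₁ (maps φ)) (F₁ (legs D′)) ⟩
      F₁ (legs D′) ∘ (F₁ (maps φ) ∘ head D)   ∎)
      where open ≡-Reasoning

    module _ (s2 : S2 H) {X Y : Objs} {f : Homs X Y}
             (f-pw : ∀ i → PathwiseEmbedding (A i) (f i)) where

      F₁-pathwiseEmbedding : PathwiseEmbedding B (F₁ f)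
      F₁-pathwiseEmbedding e e-path =
        embedding-from-head (postcompose f-pw D) (head-embedding D (proj₂ e-path))
        where
        D : Decomposition e
        D = proj₁ (minimalDecomposition s2 e-path)

      F₁-open : (∀ i → Open (A i) (f i)) → Open B (F₁ f)
      F₁-open f-open e g m e-path g-path m-path F₁f∘e≡m∘g = F₁ ds ∘ head Dm , d∘g≡e , F₁f∘d≡m
        where
        open ≡-Reasoning
        De : Decomposition e
        De = proj₁ (minimalDecomposition s2 e-path)

        Dm : Decomposition m
        Dm = proj₁ (minimalDecomposition s2 m-path)

        K,minimal : Σ (Decomposition (m ∘ g)) IsMinimal
        K,minimal = minimalDecomposition s2 (PathEmbedding-∘ (proj₂ m-path) g-path)

        K : Decomposition (m ∘ g)
        K = proj₁ K,minimal

        α : DecompositionMap K (transport F₁f∘e≡m∘g (postcompose f-pw De))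
        α = proj₂ K,minimal _

        β : DecompositionMap K (precompose Dm g)
        β = proj₂ K,minimal _

        square : ∀ i → A._∘_ i (f i) ((legs De ⊚ maps α) i) ≡ (legs Dm ⊚ maps β) i
        square i = trans (sym (A.assoc i (maps α i) (legs De i) (f i)))
                         (trans (sym (legs-commute α i)) (legs-commute β i))

        filler : ∀ i → Σ (A.Hom i (Ps Dm i) (X i)) λ d →
                   (A._∘_ i d (maps β i) ≡ (legs De ⊚ maps α) i) × (A._∘_ i (f i) d ≡ legs Dm i)
        filler i = f-open i _ (maps β i) (legs Dm i)
                     (EA.PathEmbedding-∘ i (proj₂ (legs-path De i)) (maps-pathEmbedding α i))
                     (maps-pathEmbedding β i) (legs-path Dm i) (square i)

        ds : Homs (Ps Dm) X
        ds i = proj₁ (filler i)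

        F₁f∘d≡m : F₁ f ∘ (F₁ ds ∘ head Dm) ≡ m
        F₁f∘d≡m = begin
          F₁ f ∘ (F₁ ds ∘ head Dm)   ≡⟨ sym (assoc (head Dm) (F₁ ds) (F₁ f)) ⟩
          (F₁ f ∘ F₁ ds) ∘ head Dm   ≡⟨ cong (_∘ head Dm) (sym (F₁-⊚ λ i → sym (proj₂ (proj₂ (filler i))))) ⟩
          F₁ (legs Dm) ∘ head Dm     ≡⟨ factorises Dm ⟩
          m                          ∎

        d∘g≡e : (F₁ ds ∘ head Dm) ∘ g ≡ e
        d∘g≡e = begin
          (F₁ ds ∘ head Dm) ∘ g                   ≡⟨ assoc g (head Dm) (F₁ ds) ⟩
          F₁ ds ∘ (head Dm ∘ g)                   ≡⟨ cong (F₁ ds ∘_) (head-commute β) ⟩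
          F₁ ds ∘ (F₁ (maps β) ∘ head K)          ≡⟨ sym (assoc (head K) (F₁ (maps β)) (F₁ ds)) ⟩
          (F₁ ds ∘ F₁ (maps β)) ∘ head K          ≡⟨ cong (_∘ head K) (sym (F-∘ (maps β) ds)) ⟩
          F₁ (ds ⊚ maps β) ∘ head K               ≡⟨ cong (_∘ head K) (F₁-⊚ λ i → proj₁ (proj₂ (filler i))) ⟩
          (F₁ (legs De) ∘ F₁ (maps α)) ∘ head K   ≡⟨ assoc (head K) (F₁ (maps α)) (F₁ (legs De)) ⟩
          F₁ (legs De) ∘ (F₁ (maps α) ∘ head K)   ≡⟨ cong (F₁ (legs De) ∘_) (sym (head-commute α)) ⟩
          F₁ (legs De) ∘ head De                  ≡⟨ factorises De ⟩
          e                                       ∎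

theorem5p17 : ∀ {o ℓ o' ℓ' : Level} (n : ℕ)
    (A : Fin n → PathCategory o ℓ) (B : PathCategory o' ℓ')
    (H : MultiFunctor n A B) → S1 H → S2 H →
    ∀ {X Y : (i : Fin n) → PathCategory.Obj (A i)}
      (f : (i : Fin n) → PathCategory.Hom (A i) (X i) (Y i)) →
    (∀ i → Open (A i) (f i) × PathwiseEmbedding (A i) (f i)) →
    Open B (MultiFunctor.F₁ H f) × PathwiseEmbedding B (MultiFunctor.F₁ H f)
theorem5p17 n A B H s1 s2 f f-open-pw =
  F₁-open H s1 s2 f-pw (λ i → proj₁ (f-open-pw i)) , F₁-pathwiseEmbedding H s1 s2 f-pw
  where
  f-pw : ∀ i → PathwiseEmbedding (A i) (f i)
  f-pw i = proj₂ (f-open-pw i)
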